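{- Let $\alpha_1,\dots,\alpha_n\in\mathbb{R}^d$ be linearly independent, let $1\le r\le n$ and $k\in\{0,\dots,r\}$, and let $\gamma=\alpha_1+\cdots+\alpha_k-\alpha_{k+1}-\cdots-\alpha_r$. Then $$\frac{1}{\prod_{i=1}^r(1-\mathbf{y}^{\alpha_i})}=L_1(\mathbf{y})+L_2(\mathbf{y}),$$ where $$L_1(\mathbf{y})=\sum_{j=1}^{k}\frac{(-1)^{j-1}}{(1-\mathbf{y}^{\gamma})\prod_{i=1}^{j-1}(1-\mathbf{y}^{ -\alpha_i})\prod_{i=j+1}^{r}(1-\mathbf{y}^{\alpha_i})},$$ $$L_2(\mathbf{y})=\sum_{j=k+1}^{r}\frac{(-1)^{j-(k+1)}}{(1-\mathbf{y}^{ -\gamma})\prod_{i=1}^{k}(1-\mathbf{y}^{\alpha_i})\prod_{i=k+1}^{j-1}(1-\mathbf{y}^{ -\alpha_i})\prod_{i=j+1}^{r}(1-\mathbf{y}^{\alpha_i})}.$$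
   Context: $\mathbf{y}^{\beta}$ for $\beta\in\mathbb{R}^d$ denotes a formal monomial with $\mathbf{y}^{\beta}\mathbf{y}^{\beta'}=\mathbf{y}^{\beta+\beta'}$ and $\mathbf{y}^{\mathbf 0}=1$; the identity is one of rational functions in these monomials. Empty sums are $0$ and empty products are $1$. -}

module Defs where

open import Level using (Level; _⊔_; suc)
open import Algebra.Bundles using (CommutativeRing; AbelianGroup)
open import Data.Nat using (ℕ; zero; _∸_) renaming (suc to 1+; _+_ to _+ℕ_)
open import Data.List using (List; foldr; map; upTo)
open import Data.Fin using (Fin; fromℕ<)
open import Data.Nat using (_<?_)
open import Relation.Nullary using (¬_; yes; no)

-- A field presented as a commutative ring with an inverse operation that
-- is a genuine multiplicative inverse on every nonzero element.
-- (Its value on 0 is irrelevant; 1/x below is only used for x ≠ 0.)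
record DivField c ℓ : Set (suc (c ⊔ ℓ)) where
  field
    commutativeRing : CommutativeRing c ℓ
  open CommutativeRing commutativeRing public
  field
    inv         : Carrier → Carrier
    inv-inverse : ∀ x → ¬ (x ≈ 0#) → x * inv x ≈ 1#

range : ℕ → ℕ → List ℕ
range a b = map (a +ℕ_) (upTo (1+ b ∸ a))

-- F : the coefficient field of the rational functions,
--   G : the (additive) exponent group (ℝ^d in the paper),
--   y : β ↦ 𝐲^β, the formal monomials,
--   α : the vectors α₁ … αₙ (α i is α_{i+1}, Fin is 0-based).
module Expr {c ℓ c' ℓ'} (F : DivField c ℓ) (G : AbelianGroup c' ℓ')
            {n : ℕ} (y : AbelianGroup.Carrier G → DivField.Carrier F)
            (α : Fin n → AbelianGroup.Carrier G) where

  open DivField F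
  module G = AbelianGroup G

  -- α_i for 1 ≤ i ≤ n (1-based); 0 outside this range (never used there).
  α' : ℕ → G.Carrier
  α' zero = G.ε
  α' (1+ i) with i <? n
  ... | yes i<n = α (fromℕ< i<n)
  ... | no  _   = G.ε

  ∏[_,_] : ℕ → ℕ → (ℕ → Carrier) → Carrier
  ∏[ a , b ] f = foldr _*_ 1# (map f (range a b))

  ∑[_,_] : ℕ → ℕ → (ℕ → Carrier) → Carrier
  ∑[ a , b ] f = foldr _+_ 0# (map f (range a b))

  ∑G[_,_] : ℕ → ℕ → (ℕ → G.Carrier) → G.Carrier
  ∑G[ a , b ] f = foldr G._∙_ G.ε (map f (range a b))

  sgn : ℕ → Carrier
  sgn zero   = 1#
  sgn (1+ m) = - sgn m

  d : G.Carrier → Carrier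
  d β = 1# - y β

  γ : ℕ → ℕ → G.Carrier
  γ r k = ∑G[ 1 , k ] α' G.∙ (∑G[ 1+ k , r ] α' G.⁻¹)

  LHS : ℕ → Carrier
  LHS r = inv (∏[ 1 , r ] (λ i → d (α' i)))

  L₁ : ℕ → ℕ → Carrier
  L₁ r k = ∑[ 1 , k ] λ j →
    sgn (j ∸ 1) * inv ( d (γ r k)
                      * ∏[ 1 , j ∸ 1 ] (λ i → d (α' i G.⁻¹))
                      * ∏[ 1+ j , r ] (λ i → d (α' i)))

  L₂ : ℕ → ℕ → Carrier
  L₂ r k = ∑[ 1+ k , r ] λ j →
    sgn (j ∸ 1+ k) * inv ( d (γ r k G.⁻¹)
                         * ∏[ 1 , k ] (λ i → d (α' i))
                         * ∏[ 1+ k , j ∸ 1 ] (λ i → d (α' i G.⁻¹))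
                         * ∏[ 1+ j , r ] (λ i → d (α' i)))

-- Write xᵢ = 1/(1 - 𝐲^{αᵢ}) and U = x₁⋯x_r, so that the left-hand side is U. Since
-- 1/(1 - 𝐲^{-β}) = -𝐲^β/(1 - 𝐲^β), the sign (-1)^{j-1} of the j-th summand of L₁ cancels
-- and that summand becomes U/(1 - 𝐲^γ) · 𝐲^{α₁+⋯+α_{j-1}} (1 - 𝐲^{αⱼ}); likewise the j-th
-- summand of L₂ is U/(1 - 𝐲^{-γ}) · 𝐲^{α_{k+1}+⋯+α_{j-1}} (1 - 𝐲^{αⱼ}). Both sums telescope:
-- with A = 𝐲^{α₁+⋯+α_k} and B = 𝐲^{α_{k+1}+⋯+α_r},
--   L₁ = U (1 - A)/(1 - 𝐲^γ)   and   L₂ = U (1 - B)/(1 - 𝐲^{-γ}) = -U 𝐲^γ (1 - B)/(1 - 𝐲^γ),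
-- and since 𝐲^γ B = A, L₁ + L₂ = U (1 - A + A - 𝐲^γ)/(1 - 𝐲^γ) = U.

module Submission where

open import Defs
open import Algebra.Bundles using (AbelianGroup; CommutativeMonoid; CommutativeRing)
import Algebra.Properties.CommutativeSemigroup as CommutativeSemigroupProperties
open import Data.Nat using (ℕ; zero; _≤_; _<_; _∸_; _≤?_; _<?_; z≤n; s≤s; s≤s⁻¹)
  renaming (suc to 1+; _+_ to _+ℕ_)
open import Data.Nat.Properties
  using (≤-refl; ≤-trans; n≤1+n; ≰⇒>; m≤m+n; +-∸-comm; m+[n∸m]≡n; m+n∸n≡m; m≤n⇒m∸n≡0)
import Data.Nat.Properties as ℕ
open import Data.Fin using (Fin; toℕ; fromℕ<)
open import Data.Fin.Properties using (toℕ-fromℕ<)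
open import Data.List using (List; []; _∷_; _++_; [_]; foldr; map; length; upTo; applyUpTo)
open import Data.List.Properties using (map-upTo; map-cong; length-map; length-upTo)
import Data.List.Relation.Unary.All as All
open All using (All; []; _∷_)
open import Data.List.Relation.Unary.All.Properties using (map⁺; applyUpTo⁺₁)
open import Function using (_∘_; id)
open import Relation.Nullary using (¬_; yes; no; contradiction)
import Relation.Binary.PropositionalEquality as ≡
open ≡ using (_≡_; module ≡-Reasoning)

module ListFold {c ℓ} (M : CommutativeMonoid c ℓ) where
  open CommutativeMonoid M
  open CommutativeSemigroupProperties commutativeSemigroup using (interchange)

  fold : {A : Set} → List A → (A → Carrier) → Carrier
  fold L f = foldr _∙_ ε (map f L)

  fold-++ : ∀ {A : Set} (L L′ : List A) f → fold (L ++ L′) f ≈ fold L f ∙ fold L′ f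
  fold-++ []      L′ f = sym (identityˡ _)
  fold-++ (i ∷ L) L′ f = trans (∙-congˡ (fold-++ L L′ f)) (sym (assoc _ _ _))

  fold-cong : ∀ {A : Set} {L : List A} {f g : A → Carrier} →
              All (λ i → f i ≈ g i) L → fold L f ≈ fold L g
  fold-cong []            = refl
  fold-cong (fi≈gi ∷ f≈g) = ∙-cong fi≈gi (fold-cong f≈g)

  fold-distrib : ∀ {A : Set} (L : List A) f g → fold L (λ i → f i ∙ g i) ≈ fold L f ∙ fold L g
  fold-distrib []      f g = sym (identityˡ ε)
  fold-distrib (i ∷ L) f g = trans (∙-congˡ (fold-distrib L f g)) (interchange _ _ _ _)

applyUpTo-++ : ∀ {A : Set} (f : ℕ → A) m n →
               applyUpTo f (m +ℕ n) ≡ applyUpTo f m ++ applyUpTo (f ∘ (m +ℕ_)) n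
applyUpTo-++ f zero   n = ≡.refl
applyUpTo-++ f (1+ m) n = ≡.cong (f 0 ∷_) (applyUpTo-++ (f ∘ 1+) m n)

map-upTo-++ : ∀ {A : Set} (f : ℕ → A) m n →
              map f (upTo (m +ℕ n)) ≡ map f (upTo m) ++ map (f ∘ (m +ℕ_)) (upTo n)
map-upTo-++ f m n = begin
  map f (upTo (m +ℕ n))                          ≡⟨ map-upTo f (m +ℕ n) ⟩
  applyUpTo f (m +ℕ n)                           ≡⟨ applyUpTo-++ f m n ⟩
  applyUpTo f m ++ applyUpTo (f ∘ (m +ℕ_)) n     ≡⟨ ≡.cong₂ _++_ (map-upTo f m) (map-upTo _ n) ⟨
  map f (upTo m) ++ map (f ∘ (m +ℕ_)) (upTo n)   ∎
  where open ≡-Reasoning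

range-++ : ∀ {a m b} → a ≤ 1+ m → m ≤ b → range a b ≡ range a m ++ range (1+ m) b
range-++ {a} {m} {b} a≤1+m m≤b = begin
  map (a +ℕ_) (upTo (1+ b ∸ a))                         ≡⟨ ≡.cong (map (a +ℕ_) ∘ upTo) length-split ⟩
  map (a +ℕ_) (upTo (l +ℕ (b ∸ m)))                     ≡⟨ map-upTo-++ (a +ℕ_) l (b ∸ m) ⟩
  range a m ++ map (λ i → a +ℕ (l +ℕ i)) (upTo (b ∸ m))
    ≡⟨ ≡.cong (range a m ++_) (map-cong shift (upTo (b ∸ m))) ⟩
  range a m ++ range (1+ m) b                           ∎
  where
  open ≡-Reasoning
  l : ℕ
  l = 1+ m ∸ a
  length-split : 1+ b ∸ a ≡ l +ℕ (b ∸ m)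
  length-split = ≡.trans (≡.cong (λ t → 1+ t ∸ a) (≡.sym (m+[n∸m]≡n m≤b))) (+-∸-comm (b ∸ m) a≤1+m)
  shift : ∀ i → a +ℕ (l +ℕ i) ≡ 1+ m +ℕ i
  shift i = ≡.trans (≡.sym (ℕ.+-assoc a l i)) (≡.cong (_+ℕ i) (m+[n∸m]≡n a≤1+m))

range-singleton : ∀ a → range a a ≡ [ a ]
range-singleton a =
  ≡.trans (≡.cong (map (a +ℕ_) ∘ upTo) (m+n∸n≡m 1 a)) (≡.cong [_] (ℕ.+-identityʳ a))

range-empty : ∀ {a b} → b < a → range a b ≡ []
range-empty {a} b<a = ≡.cong (map (a +ℕ_) ∘ upTo) (m≤n⇒m∸n≡0 b<a)

range-∷ : ∀ {a b} → a ≤ b → range a b ≡ a ∷ range (1+ a) b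
range-∷ {a} {b} a≤b =
  ≡.trans (range-++ (n≤1+n a) a≤b) (≡.cong (_++ range (1+ a) b) (range-singleton a))

range-∷ʳ : ∀ {a b} → a ≤ 1+ b → range a (1+ b) ≡ range a b ++ [ 1+ b ]
range-∷ʳ {a} {b} a≤1+b =
  ≡.trans (range-++ a≤1+b (n≤1+n b)) (≡.cong (range a b ++_) (range-singleton (1+ b)))

length-range : ∀ a b → length (range a b) ≡ 1+ b ∸ a
length-range a b = ≡.trans (length-map (a +ℕ_) (upTo (1+ b ∸ a))) (length-upTo (1+ b ∸ a))

m<n∸o⇒o+m<n : ∀ {m n} o → m < n ∸ o → o +ℕ m < n
m<n∸o⇒o+m<n            zero   m<n   = m<n
m<n∸o⇒o+m<n {n = 1+ n} (1+ o) m<n∸o = s≤s (m<n∸o⇒o+m<n o m<n∸o)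

All-range : ∀ {p} {P : ℕ → Set p} {a b} → (∀ {i} → a ≤ i → i ≤ b → P i) → All P (range a b)
All-range {a = a} {b} P[a,b] =
  map⁺ (applyUpTo⁺₁ id (1+ b ∸ a) (λ {i} i<l → P[a,b] (m≤m+n a i) (s≤s⁻¹ (m<n∸o⇒o+m<n a i<l))))

module RingProducts {c ℓ} (R : CommutativeRing c ℓ) where
  open CommutativeRing R
  open import Relation.Binary.Reasoning.Setoid setoid
  open import Algebra.Properties.Ring ring using (x[y-z]≈xy-xz)
  open CommutativeSemigroupProperties *-commutativeSemigroup using (xy∙z≈y∙xz)
  open ListFold +-commutativeMonoid public
    using () renaming (fold to ∑; fold-++ to ∑-++; fold-cong to ∑-cong)
  open ListFold *-commutativeMonoid public
    using () renaming (fold to ∏; fold-++ to ∏-++; fold-cong to ∏-cong; fold-distrib to ∏-distrib-*)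

  *-distribˡ-∑ : ∀ {A : Set} x (L : List A) f → ∑ L (λ i → x * f i) ≈ x * ∑ L f
  *-distribˡ-∑ x []      f = sym (zeroʳ x)
  *-distribˡ-∑ x (i ∷ L) f = trans (+-congˡ (*-distribˡ-∑ x L f)) (sym (distribˡ x _ _))

  ∏-range-++ : ∀ f {a m b} → a ≤ 1+ m → m ≤ b →
               ∏ (range a b) f ≈ ∏ (range a m) f * ∏ (range (1+ m) b) f
  ∏-range-++ f {a} {m} {b} a≤1+m m≤b =
    trans (reflexive (≡.cong (λ L → ∏ L f) (range-++ a≤1+m m≤b))) (∏-++ (range a m) (range (1+ m) b) f)

  ∏-range-split : ∀ f {a j b} → a ≤ 1+ j → 1+ j ≤ b →
                  ∏ (range a b) f ≈ ∏ (range a j) f * (f (1+ j) * ∏ (range (1+ (1+ j)) b) f)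
  ∏-range-split f {j = j} a≤1+j 1+j≤b =
    trans (∏-range-++ f a≤1+j (≤-trans (n≤1+n j) 1+j≤b))
          (*-congˡ (reflexive (≡.cong (λ L → ∏ L f) (range-∷ 1+j≤b))))

  ∏-range-remove : ∀ f {a j b t} → a ≤ 1+ j → 1+ j ≤ b → f (1+ j) * t ≈ 1# →
                   ∏ (range a j) f * ∏ (range (1+ (1+ j)) b) f ≈ ∏ (range a b) f * t
  ∏-range-remove f {a} {j} {b} {t} a≤1+j 1+j≤b fⱼt≈1 = begin
    F⁻ * F⁺                      ≈⟨ *-congˡ (*-identityʳ F⁺) ⟨
    F⁻ * (F⁺ * 1#)               ≈⟨ *-congˡ (*-congˡ fⱼt≈1) ⟨
    F⁻ * (F⁺ * (f (1+ j) * t))   ≈⟨ *-congˡ (xy∙z≈y∙xz (f (1+ j)) F⁺ t) ⟨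
    F⁻ * (f (1+ j) * F⁺ * t)     ≈⟨ *-assoc F⁻ (f (1+ j) * F⁺) t ⟨
    F⁻ * (f (1+ j) * F⁺) * t     ≈⟨ *-congʳ (∏-range-split f a≤1+j 1+j≤b) ⟨
    ∏ (range a b) f * t          ∎
    where
    F⁻ F⁺ : Carrier
    F⁻ = ∏ (range a j) f
    F⁺ = ∏ (range (1+ (1+ j)) b) f

  [x-y]+[y-z]≈x-z : ∀ x y z → (x - y) + (y - z) ≈ x - z
  [x-y]+[y-z]≈x-z x y z = begin
    (x - y) + (y - z)     ≈⟨ +-assoc x (- y) (y - z) ⟩
    x + (- y + (y - z))   ≈⟨ +-congˡ (+-assoc (- y) y (- z)) ⟨
    x + ((- y + y) - z)   ≈⟨ +-congˡ (+-congʳ (-‿inverseˡ y)) ⟩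
    x + (0# - z)          ≈⟨ +-congˡ (+-identityˡ (- z)) ⟩
    x - z                 ∎

  -- 1 ≤ s is needed because j ∸ 1 is truncated at j = 0.
  ∑-telescope : ∀ (a : ℕ → Carrier) {s} e → 1 ≤ s →
    ∑ (range s e) (λ j → ∏ (range s (j ∸ 1)) a * (1# - a j)) ≈ 1# - ∏ (range s e) a
  ∑-telescope a {s} e 1≤s with s ≤? e
  ∑-telescope a         e      1≤s       | no s≰e
    rewrite range-empty (≰⇒> s≰e) = sym (-‿inverseʳ 1#)
  ∑-telescope a         zero   (s≤s _)   | yes ()
  ∑-telescope a {s}     (1+ e) 1≤s       | yes s≤1+e
    rewrite range-∷ʳ s≤1+e = begin
      ∑ (range s e ++ [ 1+ e ]) term                  ≈⟨ ∑-++ (range s e) [ 1+ e ] term ⟩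
      ∑ (range s e) term + (term (1+ e) + 0#)         ≈⟨ +-cong (∑-telescope a e 1≤s) (+-identityʳ _) ⟩
      (1# - P) + P * (1# - a (1+ e))                  ≈⟨ +-congˡ (x[y-z]≈xy-xz P 1# (a (1+ e))) ⟩
      (1# - P) + (P * 1# - P * a (1+ e))              ≈⟨ +-congˡ (+-congʳ (*-identityʳ P)) ⟩
      (1# - P) + (P - P * a (1+ e))                   ≈⟨ [x-y]+[y-z]≈x-z 1# P _ ⟩
      1# - P * a (1+ e)                               ≈⟨ +-congˡ (-‿cong (*-congˡ (*-identityʳ _))) ⟨
      1# - P * (a (1+ e) * 1#)                        ≈⟨ +-congˡ (-‿cong (∏-++ (range s e) [ 1+ e ] a)) ⟨
      1# - ∏ (range s e ++ [ 1+ e ]) a                ∎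
    where
    term : ℕ → Carrier
    term j = ∏ (range s (j ∸ 1)) a * (1# - a j)
    P : Carrier
    P = ∏ (range s e) a

module DivFieldProperties {c ℓ} (F : DivField c ℓ) where
  open DivField F
  open RingProducts commutativeRing public
  open import Relation.Binary.Reasoning.Setoid setoid
  open import Algebra.Properties.Ring ring
    using (-‿involutive; -‿distribˡ-*; -‿distribʳ-*; x[y-z]≈xy-xz; [y-z]x≈yx-zx)
  open import Algebra.Properties.AbelianGroup +-abelianGroup using (⁻¹-anti-homo‿-)
  open CommutativeSemigroupProperties *-commutativeSemigroup using (interchange; xy∙z≈y∙xz; xy∙z≈xz∙y)

  inv-inverseˡ : ∀ {x} → x ≉ 0# → inv x * x ≈ 1#
  inv-inverseˡ {x} x≉0 = trans (*-comm (inv x) x) (inv-inverse x x≉0)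

  inv-cancelˡ : ∀ {x} z → x ≉ 0# → inv x * (x * z) ≈ z
  inv-cancelˡ {x} z x≉0 = begin
    inv x * (x * z) ≈⟨ *-assoc (inv x) x z ⟨
    inv x * x * z   ≈⟨ *-congʳ (inv-inverseˡ x≉0) ⟩
    1# * z          ≈⟨ *-identityˡ z ⟩
    z               ∎

  -- inv is not assumed to be a congruence; everything about it is derived from the
  -- uniqueness of inverses.
  inverseʳ-unique : ∀ {x z} → x ≉ 0# → x * z ≈ 1# → z ≈ inv x
  inverseʳ-unique {x} {z} x≉0 xz≈1 =
    trans (sym (inv-cancelˡ z x≉0)) (trans (*-congˡ xz≈1) (*-identityʳ (inv x)))

  *-≉0 : ∀ {x z} → x ≉ 0# → z ≉ 0# → x * z ≉ 0#
  *-≉0 {x} {z} x≉0 z≉0 xz≈0 =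
    z≉0 (trans (sym (inv-cancelˡ z x≉0)) (trans (*-congˡ xz≈0) (zeroʳ (inv x))))

  x≉0⇒1≉0 : ∀ {x} → x ≉ 0# → 1# ≉ 0#
  x≉0⇒1≉0 {x} x≉0 1≈0 = x≉0 (begin
    x       ≈⟨ *-identityʳ x ⟨
    x * 1#  ≈⟨ *-congˡ 1≈0 ⟩
    x * 0#  ≈⟨ zeroʳ x ⟩
    0#      ∎)

  inv-* : ∀ {x z} → x ≉ 0# → z ≉ 0# → inv (x * z) ≈ inv x * inv z
  inv-* {x} {z} x≉0 z≉0 = sym (inverseʳ-unique (*-≉0 x≉0 z≉0) (begin
    x * z * (inv x * inv z)       ≈⟨ interchange x z (inv x) (inv z) ⟩
    x * inv x * (z * inv z)       ≈⟨ *-cong (inv-inverse x x≉0) (inv-inverse z z≉0) ⟩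
    1# * 1#                       ≈⟨ *-identityˡ 1# ⟩
    1#                            ∎))

  ∏-≉0 : ∀ {A : Set} {L : List A} {f : A → Carrier} → 1# ≉ 0# →
         All (λ i → f i ≉ 0#) L → ∏ L f ≉ 0#
  ∏-≉0 1≉0 []           = 1≉0
  ∏-≉0 1≉0 (fi≉0 ∷ f≉0) = *-≉0 fi≉0 (∏-≉0 1≉0 f≉0)

  inv-∏ : ∀ {A : Set} {L : List A} {f : A → Carrier} → 1# ≉ 0# →
          All (λ i → f i ≉ 0#) L → inv (∏ L f) ≈ ∏ L (λ i → inv (f i))
  inv-∏ 1≉0 []           = sym (inverseʳ-unique 1≉0 (*-identityˡ 1#))
  inv-∏ 1≉0 (fi≉0 ∷ f≉0) = trans (inv-* fi≉0 (∏-≉0 1≉0 f≉0)) (*-congˡ (inv-∏ 1≉0 f≉0))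

  [1-z]*-x≈1-x : ∀ {x z} → x * z ≈ 1# → (1# - z) * - x ≈ 1# - x
  [1-z]*-x≈1-x {x} {z} xz≈1 = begin
    (1# - z) * - x          ≈⟨ [y-z]x≈yx-zx (- x) 1# z ⟩
    1# * - x - z * - x      ≈⟨ +-cong (*-identityˡ (- x)) (-‿cong (sym (-‿distribʳ-* z x))) ⟩
    - x - - (z * x)         ≈⟨ +-congˡ (-‿involutive (z * x)) ⟩
    - x + z * x             ≈⟨ +-comm (- x) (z * x) ⟩
    z * x - x               ≈⟨ +-congʳ (trans (*-comm z x) xz≈1) ⟩
    1# - x                  ∎

  1-x⁻¹≉0 : ∀ {x z} → x * z ≈ 1# → 1# - x ≉ 0# → 1# - z ≉ 0#
  1-x⁻¹≉0 {x} {z} xz≈1 1-x≉0 1-z≈0 = 1-x≉0 (begin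
    1# - x          ≈⟨ [1-z]*-x≈1-x xz≈1 ⟨
    (1# - z) * - x  ≈⟨ *-congʳ 1-z≈0 ⟩
    0# * - x        ≈⟨ zeroˡ (- x) ⟩
    0#              ∎)

  inv[1-x⁻¹] : ∀ {x z} → x * z ≈ 1# → 1# - x ≉ 0# → inv (1# - z) ≈ - (x * inv (1# - x))
  inv[1-x⁻¹] {x} {z} xz≈1 1-x≉0 = sym (inverseʳ-unique (1-x⁻¹≉0 xz≈1 1-x≉0) (begin
    (1# - z) * - (x * inv (1# - x))   ≈⟨ *-congˡ (-‿distribˡ-* x (inv (1# - x))) ⟩
    (1# - z) * (- x * inv (1# - x))   ≈⟨ *-assoc (1# - z) (- x) (inv (1# - x)) ⟨
    (1# - z) * - x * inv (1# - x)     ≈⟨ *-congʳ ([1-z]*-x≈1-x xz≈1) ⟩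
    (1# - x) * inv (1# - x)           ≈⟨ inv-inverse (1# - x) 1-x≉0 ⟩
    1#                                ∎))

  partial-fraction-pair : ∀ {g g′ A B} U → g * g′ ≈ 1# → g * B ≈ A → 1# - g ≉ 0# →
    inv (1# - g) * U * (1# - A) + inv (1# - g′) * U * (1# - B) ≈ U
  partial-fraction-pair {g} {g′} {A} {B} U gg′≈1 gB≈A 1-g≉0 = begin
    κ * U * (1# - A) + inv (1# - g′) * U * (1# - B)
      ≈⟨ +-congˡ (*-congʳ (*-congʳ (inv[1-x⁻¹] gg′≈1 1-g≉0))) ⟩
    κ * U * (1# - A) + - (g * κ) * U * (1# - B)   ≈⟨ +-congˡ second-summand ⟩
    κ * U * (1# - A) + κ * U * (A - g)            ≈⟨ distribˡ (κ * U) (1# - A) (A - g) ⟨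
    κ * U * ((1# - A) + (A - g))                  ≈⟨ *-congˡ ([x-y]+[y-z]≈x-z 1# A g) ⟩
    κ * U * (1# - g)                              ≈⟨ xy∙z≈xz∙y κ U (1# - g) ⟩
    κ * (1# - g) * U                              ≈⟨ *-congʳ (inv-inverseˡ 1-g≉0) ⟩
    1# * U                                        ≈⟨ *-identityˡ U ⟩
    U                                             ∎
    where
    κ : Carrier
    κ = inv (1# - g)
    second-summand : - (g * κ) * U * (1# - B) ≈ κ * U * (A - g)
    second-summand = begin
      - (g * κ) * U * (1# - B)     ≈⟨ *-congʳ (-‿distribˡ-* (g * κ) U) ⟨
      - (g * κ * U) * (1# - B)     ≈⟨ -‿distribˡ-* (g * κ * U) (1# - B) ⟨
      - (g * κ * U * (1# - B))     ≈⟨ -‿cong (*-congʳ (*-assoc g κ U)) ⟩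
      - (g * (κ * U) * (1# - B))   ≈⟨ -‿cong (xy∙z≈y∙xz g (κ * U) (1# - B)) ⟩
      - (κ * U * (g * (1# - B)))   ≈⟨ -‿distribʳ-* (κ * U) (g * (1# - B)) ⟩
      κ * U * - (g * (1# - B))     ≈⟨ *-congˡ (-‿cong (x[y-z]≈xy-xz g 1# B)) ⟩
      κ * U * - (g * 1# - g * B)   ≈⟨ *-congˡ (-‿cong (+-cong (*-identityʳ g) (-‿cong gB≈A))) ⟩
      κ * U * - (g - A)            ≈⟨ *-congˡ (⁻¹-anti-homo‿- g A) ⟩
      κ * U * (A - g)              ∎

module PartialFractions {c ℓ c′ ℓ′} (F : DivField c ℓ) (G : AbelianGroup c′ ℓ′)
  (y : AbelianGroup.Carrier G → DivField.Carrier F)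
  (y-cong : ∀ {β β′} → AbelianGroup._≈_ G β β′ → DivField._≈_ F (y β) (y β′))
  (y-homo : ∀ β β′ → DivField._≈_ F (y (AbelianGroup._∙_ G β β′)) (DivField._*_ F (y β) (y β′)))
  (y-ε : DivField._≈_ F (y (AbelianGroup.ε G)) (DivField.1# F))
  {n : ℕ} (α : Fin n → AbelianGroup.Carrier G) where

  open DivField F
  open DivFieldProperties F
  open Expr F G y α
  open import Relation.Binary.Reasoning.Setoid setoid
  open import Algebra.Properties.Ring ring using (-‿involutive; -‿distribˡ-*; -‿distribʳ-*)
  open import Algebra.Properties.Group G.group using (//-rightDividesˡ)
  open CommutativeSemigroupProperties *-commutativeSemigroup using (x∙yz≈y∙xz)

  y-inverse : ∀ β → y β * y (β G.⁻¹) ≈ 1#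
  y-inverse β = trans (sym (y-homo β (β G.⁻¹))) (trans (y-cong (G.inverseʳ β)) y-ε)

  y-∑ : ∀ (β : ℕ → G.Carrier) L → y (foldr G._∙_ G.ε (map β L)) ≈ ∏ L (λ i → y (β i))
  y-∑ β []      = y-ε
  y-∑ β (i ∷ L) = trans (y-homo (β i) _) (*-congˡ (y-∑ β L))

  y[γ]*∏≈∏ : ∀ r k → y (γ r k) * ∏[ 1+ k , r ] (λ i → y (α' i)) ≈ ∏[ 1 , k ] (λ i → y (α' i))
  y[γ]*∏≈∏ r k = begin
    y (Σ₁ G.∙ Σ₂ G.⁻¹) * ∏[ 1+ k , r ] (λ i → y (α' i)) ≈⟨ *-congˡ (y-∑ α' (range (1+ k) r)) ⟨
    y (Σ₁ G.∙ Σ₂ G.⁻¹) * y Σ₂                          ≈⟨ y-homo (Σ₁ G.∙ Σ₂ G.⁻¹) Σ₂ ⟨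
    y (Σ₁ G.∙ Σ₂ G.⁻¹ G.∙ Σ₂)                           ≈⟨ y-cong (//-rightDividesˡ Σ₂ Σ₁) ⟩
    y Σ₁                                                ≈⟨ y-∑ α' (range 1 k) ⟩
    ∏[ 1 , k ] (λ i → y (α' i))                         ∎
    where
    Σ₁ Σ₂ : G.Carrier
    Σ₁ = ∑G[ 1 , k ] α'
    Σ₂ = ∑G[ 1+ k , r ] α'

  sgn*sgn≈1 : ∀ m → sgn m * sgn m ≈ 1#
  sgn*sgn≈1 zero   = *-identityˡ 1#
  sgn*sgn≈1 (1+ m) = begin
    - sgn m * - sgn m      ≈⟨ -‿distribˡ-* (sgn m) (- sgn m) ⟨
    - (sgn m * - sgn m)    ≈⟨ -‿cong (-‿distribʳ-* (sgn m) (sgn m)) ⟨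
    - - (sgn m * sgn m)    ≈⟨ -‿involutive (sgn m * sgn m) ⟩
    sgn m * sgn m          ≈⟨ sgn*sgn≈1 m ⟩
    1#                     ∎

  ∏-neg : ∀ {A : Set} (L : List A) f → ∏ L (λ i → - f i) ≈ sgn (length L) * ∏ L f
  ∏-neg []      f = sym (*-identityˡ 1#)
  ∏-neg (i ∷ L) f = begin
    - f i * ∏ L (λ i → - f i)        ≈⟨ *-congˡ (∏-neg L f) ⟩
    - f i * (σ * ∏ L f)              ≈⟨ -‿distribˡ-* (f i) (σ * ∏ L f) ⟨
    - (f i * (σ * ∏ L f))            ≈⟨ -‿cong (x∙yz≈y∙xz (f i) σ (∏ L f)) ⟩
    - (σ * (f i * ∏ L f))            ≈⟨ -‿distribˡ-* σ (f i * ∏ L f) ⟩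
    - σ * (f i * ∏ L f)              ∎
    where
    σ : Carrier
    σ = sgn (length L)

  sgn*inv∏d⁻¹ : ∀ (β : ℕ → G.Carrier) {L} → 1# ≉ 0# → All (λ i → d (β i) ≉ 0#) L →
    sgn (length L) * inv (∏ L (λ i → d (β i G.⁻¹)))
      ≈ ∏ L (λ i → y (β i)) * ∏ L (λ i → inv (d (β i)))
  sgn*inv∏d⁻¹ β {L} 1≉0 d≉0 = begin
    σ * inv (∏ L (λ i → d (β i G.⁻¹)))                ≈⟨ *-congˡ (inv-∏ 1≉0 (All.map d⁻¹≉0 d≉0)) ⟩
    σ * ∏ L (λ i → inv (d (β i G.⁻¹)))                ≈⟨ *-congˡ (∏-cong (All.map inv-d⁻¹ d≉0)) ⟩
    σ * ∏ L (λ i → - (y (β i) * inv (d (β i))))       ≈⟨ *-congˡ (∏-neg L _) ⟩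
    σ * (σ * ∏ L (λ i → y (β i) * inv (d (β i))))     ≈⟨ *-assoc σ σ _ ⟨
    σ * σ * ∏ L (λ i → y (β i) * inv (d (β i)))       ≈⟨ *-congʳ (sgn*sgn≈1 (length L)) ⟩
    1# * ∏ L (λ i → y (β i) * inv (d (β i)))          ≈⟨ *-identityˡ _ ⟩
    ∏ L (λ i → y (β i) * inv (d (β i)))               ≈⟨ ∏-distrib-* L _ _ ⟩
    ∏ L (λ i → y (β i)) * ∏ L (λ i → inv (d (β i)))   ∎
    where
    σ : Carrier
    σ = sgn (length L)
    d⁻¹≉0 : ∀ {i} → d (β i) ≉ 0# → d (β i G.⁻¹) ≉ 0#
    d⁻¹≉0 {i} = 1-x⁻¹≉0 (y-inverse (β i))
    inv-d⁻¹ : ∀ {i} → d (β i) ≉ 0# → inv (d (β i G.⁻¹)) ≈ - (y (β i) * inv (d (β i)))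
    inv-d⁻¹ {i} = inv[1-x⁻¹] (y-inverse (β i))

  partial-fraction-term : ∀ {s j r w} → 1 ≤ s → s ≤ j → j ≤ r → w ≉ 0# →
    (∀ {i} → s ≤ i → i ≤ r → d (α' i) ≉ 0#) →
    sgn (j ∸ s) * inv (w * ∏[ s , j ∸ 1 ] (λ i → d (α' i G.⁻¹)) * ∏[ 1+ j , r ] (λ i → d (α' i)))
      ≈ inv w * ∏[ s , r ] (λ i → inv (d (α' i))) * (∏[ s , j ∸ 1 ] (λ i → y (α' i)) * d (α' j))
  partial-fraction-term {j = zero} (s≤s _) ()
  partial-fraction-term {s} {1+ j} {r} {w} 1≤s s≤1+j 1+j≤r w≉0 d≉0 = begin
    sgn (1+ j ∸ s) * inv (w * P⁻ * P⁺)
      ≡⟨ ≡.cong (λ m → sgn m * inv (w * P⁻ * P⁺)) (length-range s j) ⟨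
    σ * inv (w * P⁻ * P⁺)
      ≈⟨ *-congˡ (trans (inv-* (*-≉0 w≉0 P⁻≉0) P⁺≉0) (*-congʳ (inv-* w≉0 P⁻≉0))) ⟩
    σ * (inv w * inv P⁻ * inv P⁺)        ≈⟨ *-congˡ (*-assoc (inv w) (inv P⁻) (inv P⁺)) ⟩
    σ * (inv w * (inv P⁻ * inv P⁺))      ≈⟨ x∙yz≈y∙xz σ (inv w) (inv P⁻ * inv P⁺) ⟩
    inv w * (σ * (inv P⁻ * inv P⁺))      ≈⟨ *-congˡ (*-assoc σ (inv P⁻) (inv P⁺)) ⟨
    inv w * (σ * inv P⁻ * inv P⁺)
      ≈⟨ *-congˡ (*-cong (sgn*inv∏d⁻¹ α' 1≉0 (All-range d≉0[s,j])) (inv-∏ 1≉0 d≉0[2+j,r])) ⟩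
    inv w * (Y * X⁻ * X⁺)                ≈⟨ *-congˡ (*-assoc Y X⁻ X⁺) ⟩
    inv w * (Y * (X⁻ * X⁺))
      ≈⟨ *-congˡ (*-congˡ (∏-range-remove x s≤1+j 1+j≤r (inv-inverseˡ (d≉0 s≤1+j 1+j≤r)))) ⟩
    inv w * (Y * (X * d (α' (1+ j))))    ≈⟨ *-congˡ (x∙yz≈y∙xz Y X (d (α' (1+ j)))) ⟩
    inv w * (X * (Y * d (α' (1+ j))))    ≈⟨ *-assoc (inv w) X _ ⟨
    inv w * X * (Y * d (α' (1+ j)))      ∎
    where
    x : ℕ → Carrier
    x i = inv (d (α' i))
    σ P⁻ P⁺ X X⁻ X⁺ Y : Carrier
    σ  = sgn (length (range s j))
    P⁻ = ∏[ s , j ] (λ i → d (α' i G.⁻¹))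
    P⁺ = ∏[ 1+ (1+ j) , r ] (λ i → d (α' i))
    X  = ∏[ s , r ] x
    X⁻ = ∏[ s , j ] x
    X⁺ = ∏[ 1+ (1+ j) , r ] x
    Y  = ∏[ s , j ] (λ i → y (α' i))
    1≉0 : 1# ≉ 0#
    1≉0 = x≉0⇒1≉0 w≉0
    d≉0[s,j] : ∀ {i} → s ≤ i → i ≤ j → d (α' i) ≉ 0#
    d≉0[s,j] s≤i i≤j = d≉0 s≤i (≤-trans i≤j (≤-trans (n≤1+n j) 1+j≤r))
    d≉0[2+j,r] : All (λ i → d (α' i) ≉ 0#) (range (1+ (1+ j)) r)
    d≉0[2+j,r] = All-range (λ 2+j≤i i≤r → d≉0 (≤-trans s≤1+j (≤-trans (n≤1+n _) 2+j≤i)) i≤r)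
    P⁻≉0 : P⁻ ≉ 0#
    P⁻≉0 = ∏-≉0 1≉0 (All-range (λ {i} s≤i i≤j → 1-x⁻¹≉0 (y-inverse (α' i)) (d≉0[s,j] s≤i i≤j)))
    P⁺≉0 : P⁺ ≉ 0#
    P⁺≉0 = ∏-≉0 1≉0 d≉0[2+j,r]

  partial-fraction-sum : ∀ {s e r w} → 1 ≤ s → e ≤ r → w ≉ 0# →
    (∀ {i} → s ≤ i → i ≤ r → d (α' i) ≉ 0#) →
    ∑[ s , e ] (λ j → sgn (j ∸ s) * inv (w * ∏[ s , j ∸ 1 ] (λ i → d (α' i G.⁻¹))
                                          * ∏[ 1+ j , r ] (λ i → d (α' i))))
      ≈ inv w * ∏[ s , r ] (λ i → inv (d (α' i))) * (1# - ∏[ s , e ] (λ i → y (α' i)))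
  partial-fraction-sum {s} {e} {r} {w} 1≤s e≤r w≉0 d≉0 = begin
    ∑ (range s e) (λ j → sgn (j ∸ s) * inv (w * ∏[ s , j ∸ 1 ] (λ i → d (α' i G.⁻¹))
                                            * ∏[ 1+ j , r ] (λ i → d (α' i))))
      ≈⟨ ∑-cong (All-range (λ s≤j j≤e → partial-fraction-term 1≤s s≤j (≤-trans j≤e e≤r) w≉0 d≉0)) ⟩
    ∑ (range s e) (λ j → C * (∏[ s , j ∸ 1 ] (λ i → y (α' i)) * d (α' j)))
      ≈⟨ *-distribˡ-∑ C (range s e) _ ⟩
    C * ∑ (range s e) (λ j → ∏[ s , j ∸ 1 ] (λ i → y (α' i)) * d (α' j))
      ≈⟨ *-congˡ (∑-telescope (λ i → y (α' i)) e 1≤s) ⟩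
    C * (1# - ∏[ s , e ] (λ i → y (α' i)))
      ∎
    where
    C : Carrier
    C = inv w * ∏[ s , r ] (λ i → inv (d (α' i)))

  d∘α≉0⇒d∘α'≉0 : ∀ {r} → r ≤ n → (∀ (i : Fin n) → 1+ (toℕ i) ≤ r → d (α i) ≉ 0#) →
                  ∀ {i} → 1 ≤ i → i ≤ r → d (α' i) ≉ 0#
  d∘α≉0⇒d∘α'≉0 {r} r≤n d∘α≉0 {1+ i} _ 1+i≤r with i <? n
  ... | yes i<n = d∘α≉0 (fromℕ< i<n) (≡.subst (λ t → 1+ t ≤ r) (≡.sym (toℕ-fromℕ< i<n)) 1+i≤r)
  ... | no  i≮n = contradiction (≤-trans 1+i≤r r≤n) i≮n

  module _ {r k} (k≤r : k ≤ r) (d∘γ≉0 : d (γ r k) ≉ 0#)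
           (d∘α'≉0 : ∀ {i} → 1 ≤ i → i ≤ r → d (α' i) ≉ 0#) where

    L₁-closed : L₁ r k ≈ inv (d (γ r k)) * ∏[ 1 , r ] (λ i → inv (d (α' i)))
                                         * (1# - ∏[ 1 , k ] (λ i → y (α' i)))
    L₁-closed = partial-fraction-sum (s≤s z≤n) k≤r d∘γ≉0 d∘α'≉0

    L₂-closed : L₂ r k ≈ inv (d (γ r k G.⁻¹)) * ∏[ 1 , r ] (λ i → inv (d (α' i)))
                                              * (1# - ∏[ 1+ k , r ] (λ i → y (α' i)))
    -- The factor ∏_{i ≤ k} (1 - 𝐲^{αᵢ}) of the denominators of L₂ is taken into the constant w.
    L₂-closed = trans (partial-fraction-sum (s≤s z≤n) ≤-refl (*-≉0 w₀≉0 P≉0) d∘α'≉0[1+k,r])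
                      (*-congʳ regroup)
      where
      1≉0 : 1# ≉ 0#
      1≉0 = x≉0⇒1≉0 d∘γ≉0
      w₀ P : Carrier
      w₀ = d (γ r k G.⁻¹)
      P  = ∏[ 1 , k ] (λ i → d (α' i))
      x : ℕ → Carrier
      x i = inv (d (α' i))
      w₀≉0 : w₀ ≉ 0#
      w₀≉0 = 1-x⁻¹≉0 (y-inverse (γ r k)) d∘γ≉0
      d∘α'≉0[1,k] : All (λ i → d (α' i) ≉ 0#) (range 1 k)
      d∘α'≉0[1,k] = All-range (λ 1≤i i≤k → d∘α'≉0 1≤i (≤-trans i≤k k≤r))
      d∘α'≉0[1+k,r] : ∀ {i} → 1+ k ≤ i → i ≤ r → d (α' i) ≉ 0#
      d∘α'≉0[1+k,r] 1+k≤i = d∘α'≉0 (≤-trans (s≤s z≤n) 1+k≤i)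
      P≉0 : P ≉ 0#
      P≉0 = ∏-≉0 1≉0 d∘α'≉0[1,k]
      regroup : inv (w₀ * P) * ∏[ 1+ k , r ] x ≈ inv w₀ * ∏[ 1 , r ] x
      regroup = begin
        inv (w₀ * P) * ∏[ 1+ k , r ] x
          ≈⟨ *-congʳ (trans (inv-* w₀≉0 P≉0) (*-congˡ (inv-∏ 1≉0 d∘α'≉0[1,k]))) ⟩
        inv w₀ * ∏[ 1 , k ] x * ∏[ 1+ k , r ] x    ≈⟨ *-assoc (inv w₀) (∏[ 1 , k ] x) (∏[ 1+ k , r ] x) ⟩
        inv w₀ * (∏[ 1 , k ] x * ∏[ 1+ k , r ] x)  ≈⟨ *-congˡ (∏-range-++ x (s≤s z≤n) k≤r) ⟨
        inv w₀ * ∏[ 1 , r ] x                      ∎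

lemma3p11 : ∀ {c ℓ c' ℓ'} (F : DivField c ℓ) (G : AbelianGroup c' ℓ')
    → let open DivField F
          module G = AbelianGroup G
      in
    (y : G.Carrier → Carrier)
    → (∀ {β β'} → β G.≈ β' → y β ≈ y β')
    → (∀ β β' → y (β G.∙ β') ≈ y β * y β')
    → y G.ε ≈ 1#
    → (n : ℕ) (α : Fin n → G.Carrier) (r k : ℕ)
    → 1 ≤ r → r ≤ n → k ≤ r
    -- the denominators are nonzero (this is what linear independence of α₁ … αₙ guarantees)
    → (∀ (i : Fin n) → 1+ (toℕ i) ≤ r → ¬ (1# - y (α i) ≈ 0#))
    → ¬ (1# - y (Expr.γ F G y α r k) ≈ 0#)
    → Expr.LHS F G y α r ≈ Expr.L₁ F G y α r k + Expr.L₂ F G y α r k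
lemma3p11 F G y y-cong y-homo y-ε n α r k _ r≤n k≤r d∘α≉0 d∘γ≉0 = begin
  LHS r
    ≈⟨ inv-∏ (x≉0⇒1≉0 d∘γ≉0) (All-range d∘α'≉0) ⟩
  U
    ≈⟨ partial-fraction-pair U (y-inverse (γ r k)) (y[γ]*∏≈∏ r k) d∘γ≉0 ⟨
  inv (d (γ r k)) * U * (1# - ∏[ 1 , k ] (λ i → y (α' i)))
    + inv (d (γ r k G.⁻¹)) * U * (1# - ∏[ 1+ k , r ] (λ i → y (α' i)))
    ≈⟨ +-cong (L₁-closed k≤r d∘γ≉0 d∘α'≉0) (L₂-closed k≤r d∘γ≉0 d∘α'≉0) ⟨
  L₁ r k + L₂ r k
    ∎
  where
  open DivField F
  open DivFieldProperties F
  open PartialFractions F G y y-cong y-homo y-ε α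
  open Expr F G y α
  open import Relation.Binary.Reasoning.Setoid setoid
  d∘α'≉0 : ∀ {i} → 1 ≤ i → i ≤ r → d (α' i) ≉ 0#
  d∘α'≉0 = d∘α≉0⇒d∘α'≉0 r≤n d∘α≉0
  U : Carrier
  U = ∏[ 1 , r ] (λ i → inv (d (α' i)))
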